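{- Let $n, l$ be positive integers and $p$ a prime. Write $n = q p^k$ with $k \geq 0$ an integer and $q$ a positive integer with $p \nmid q$. Define $$\alpha(n,p) = 1 + k + \delta_{p,2}(1-\delta_{k,0}),$$ where $\delta_{ij}$ is the Kronecker delta (so $\alpha = 1+k$ unless $p=2$ and $k>0$, in which case $\alpha = 2+k$). Let $X_{l,p} = \{x' \in \mathbb{Z} : 0 \leq x' < p^l\}$. Then for each integer $r$ with $0 < r < p$, the map $C_r : X_{l,p} \to X_{l,p}$ defined by $$C_r(x') = \left\lfloor \frac{(p x' + r)^n}{p^{\alpha(n,p)}} \right\rfloor \bmod p^l$$ is a bijection (a permutation of $X_{l,p}$).
   Context: $\lfloor y \rfloor$ denotes the largest integer $\leq y$, and $a \bmod m$ denotes the least non-negative residue of $a$ modulo $m$. -}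

module Defs where

open import Data.Nat using (ℕ; zero; suc; _+_; _*_; _^_; NonZero)
open import Data.Nat.Properties using (m^n≢0)
open import Data.Nat.DivMod using (_/_; _%_; m%n<n)
open import Data.Fin using (Fin; toℕ; fromℕ<)

-- α(n,p) = 1 + k + δ_{p,2}(1 - δ_{k,0}), where k is the exponent of p in n
-- (n = q p^k, p ∤ q; the theorem supplies k together with this hypothesis).
α : (p k : ℕ) → ℕ
α 2 (suc k) = 2 + suc k
α p k       = 1 + k

-- C_r(x') = ⌊ (p x' + r)^n / p^α ⌋ mod p^l. Since p x' + r ≥ 0, ⌊·⌋ is ℕ-division.
-- Domain/codomain X_{l,p} = {0, …, p^l - 1}, represented as Fin (p ^ l).
C : (p k n l r : ℕ) → .{{_ : NonZero p}} → Fin (p ^ l) → Fin (p ^ l)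
C p k n l r x' =
  fromℕ< (m%n<n (_/_ ((p * toℕ x' + r) ^ n) (p ^ α p k) {{m^n≢0 p (α p k)}})
                (p ^ l) {{m^n≢0 p l}})

-- Write a_x = p x + r and Y x = a_x ^ n with n = q p^k. C_r x = C_r y means that ⌊Y x / p^α⌋ and
-- ⌊Y y / p^α⌋ agree mod p^l; if moreover Y x ≡ Y y (mod p^α), this says exactly Y x ≡ Y y (mod p^(α+l)).
-- Both congruences come from lifting the exponent. For a ≡ b ≢ 0 (mod p), the cofactor
-- (a^m - b^m)/(a - b) is ≡ m b^(m-1) (mod a - b), hence prime to p when p ∤ m, and it is p times a
-- unit when m = p (for p = 2 this needs 4 ∣ a - b). Since a_x - a_y = p (x - y), for odd p (or k = 0)
-- Y x - Y y is p^α (x - y) up to a unit; for p = 2 and k ≥ 1 it is 2^(α-1) (x - y)(x + y + 1) up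
-- to a unit. So Y x ≡ Y y (mod p^α) always, and mod p^(α+l) only if x = y, because |x - y| < p^l,
-- 0 < x + y + 1 < 2^(l+1) and one of x - y, x + y + 1 is odd. An injective self-map of a finite
-- set is a bijection.
module Submission where

open import Defs
open import Data.Nat using (ℕ; _*_; _^_; _<_; _≤_; NonZero)
open import Data.Nat.Divisibility using (_∣_)
open import Data.Nat.Primality using (Prime; prime⇒nonZero)
open import Relation.Nullary using (¬_)
open import Relation.Binary.PropositionalEquality using (_≡_)
open import Function.Definitions using (Bijective)

open import Data.Nat as ℕ using (zero; suc; _∸_; z≤n; s≤s)
import Data.Nat.Properties as ℕₚ
open import Data.Nat.Divisibility as ℕ using (∣1⇒≡1; ∣⇒≤; _∣0)
open import Data.Nat.Primality using (euclidsLemma; prime⇒nonTrivial; prime[2])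
open import Data.Nat.Combinatorics using (nC1≡n; nCk+nC[k+1]≡[n+1]C[k+1])
  renaming (_C_ to _choose_)
open import Data.Nat.DivMod
  using (_/_; _%_; m≡m%n+[m/n]*n; %-remove-+ʳ; m∣n⇒o%n%m≡o%m; m%[n*o]/o≡m/o%n; m<n⇒m%n≡m)
import Data.Nat.Tactic.RingSolver as ℕ-Solver
open import Data.Integer as ℤ using (ℤ; +_; _+_; _-_; -_; ∣_∣)
  renaming (_*_ to _*ᶻ_; _^_ to _^ᶻ_)
import Data.Integer.Properties as ℤₚ
open import Data.Integer.Divisibility.Signed as ℤ∣ using (∣ᵤ⇒∣; ∣⇒∣ᵤ)
  renaming (_∣_ to _∣ᶻ_)
open import Data.Integer.Tactic.RingSolver using (solve-∀)
open import Data.Fin as Fin using (Fin; toℕ)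
import Data.Fin.Properties as Finₚ
open import Data.Product using (_×_; _,_)
open import Data.Sum using (_⊎_; inj₁; inj₂; [_,_]′)
import Data.Sum as Sum
open import Data.Empty using (⊥-elim)
open import Function.Definitions using (Injective; Surjective)
open import Relation.Nullary using (yes; no)
open import Relation.Binary.PropositionalEquality
  using (_≢_; refl; sym; trans; cong; cong₂; subst; module ≡-Reasoning)

private
  variable
    a b v w x y z x′ y′ : ℤ

∣ᶻ-respˡ : x ≡ y → x ∣ᶻ z → y ∣ᶻ z
∣ᶻ-respˡ refl x∣z = x∣z

∣ᶻ-respʳ : y ≡ z → x ∣ᶻ y → x ∣ᶻ z
∣ᶻ-respʳ refl x∣y = x∣y

*-pres-∣ᶻ : a ∣ᶻ b → x ∣ᶻ y → a *ᶻ x ∣ᶻ b *ᶻ y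
*-pres-∣ᶻ {a} {b} {x} {y} a∣b x∣y = ℤ∣.∣-trans (ℤ∣.*-monoˡ-∣ x a∣b) (ℤ∣.*-monoʳ-∣ b x∣y)

pos-^ : ∀ m e → + (m ^ e) ≡ (+ m) ^ᶻ e
pos-^ m zero    = refl
pos-^ m (suc e) = trans (ℤₚ.pos-* m (m ^ e)) (cong (+ m *ᶻ_) (pos-^ m e))

pow-+-cancel-∣ : ∀ {p} .{{_ : NonZero p}} j l →
  (+ p) ^ᶻ (j ℕ.+ l) ∣ᶻ (+ p) ^ᶻ j *ᶻ z → (+ p) ^ᶻ l ∣ᶻ z
pow-+-cancel-∣ {p = p} j l pʲ⁺ˡ∣pʲz =
  ℤ∣.*-cancelˡ-∣ ((+ p) ^ᶻ j) {{pʲ≢0}} (∣ᶻ-respˡ (ℤₚ.^-distribˡ-+-* (+ p) j l) pʲ⁺ˡ∣pʲz)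
  where pʲ≢0 : ℤ.NonZero ((+ p) ^ᶻ j)
        pʲ≢0 = subst ℤ.NonZero (pos-^ p j) (ℕₚ.m^n≢0 p j)

neg-^-odd : ∀ {q} → ¬ 2 ∣ q → (- a) ^ᶻ q ≡ - (a ^ᶻ q)
neg-^-odd {q = zero}            2∤0   = ⊥-elim (2∤0 (2 ∣0))
neg-^-odd {a} {q = suc zero}    _     = sym (ℤₚ.neg-distribˡ-* a (+ 1))
neg-^-odd {a} {q = suc (suc q)} 2∤q+2 =
  trans (cong (λ z → - a *ᶻ (- a *ᶻ z)) (neg-^-odd (λ 2∣q → 2∤q+2 (ℕ.∣m∣n⇒∣m+n ℕ.∣-refl 2∣q))))
        (three-negations a (a ^ᶻ q))
  where three-negations : ∀ a A → - a *ᶻ (- a *ᶻ - A) ≡ - (a *ᶻ (a *ᶻ A))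
        three-negations = solve-∀

choose-2-suc : ∀ n → suc n choose 2 ≡ n ℕ.+ n choose 2
choose-2-suc n = trans (sym (nCk+nC[k+1]≡[n+1]C[k+1] n 1)) (cong (ℕ._+ n choose 2) (nC1≡n n))

double-choose-2 : ∀ n → 2 * (suc n choose 2) ≡ suc n * n
double-choose-2 zero    = refl
double-choose-2 (suc n) = begin
  2 * (suc (suc n) choose 2)          ≡⟨ cong (2 *_) (choose-2-suc (suc n)) ⟩
  2 * (suc n ℕ.+ suc n choose 2)      ≡⟨ ℕₚ.*-distribˡ-+ 2 (suc n) _ ⟩
  2 * suc n ℕ.+ 2 * (suc n choose 2)  ≡⟨ cong (2 * suc n ℕ.+_) (double-choose-2 n) ⟩
  2 * suc n ℕ.+ suc n * n             ≡⟨ expand n ⟩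
  suc (suc n) * suc n                 ∎
  where
  open ≡-Reasoning
  expand : ∀ n → 2 * suc n ℕ.+ suc n * n ≡ suc (suc n) * suc n
  expand = ℕ-Solver.solve-∀

p∣p-choose-2 : ∀ {p} → Prime p → p ≢ 2 → p ∣ p choose 2
p∣p-choose-2 {suc n} p-prime p≢2
  with euclidsLemma 2 (suc n choose 2) p-prime
         (ℕ.divides n (trans (double-choose-2 n) (ℕₚ.*-comm (suc n) n)))
... | inj₂ p∣C = p∣C
... | inj₁ p∣2 = ⊥-elim (p≢2 (ℕₚ.≤-antisym (∣⇒≤ p∣2) 2≤p))
  where 2≤p = ℕ.nonTrivial⇒n>1 _ {{prime⇒nonTrivial p-prime}}

≤∧∣ᶻ⇒%≡ : ∀ {N m n} .{{_ : NonZero N}} → m ≤ n → + N ∣ᶻ + m - + n → m % N ≡ n % N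
≤∧∣ᶻ⇒%≡ {N} {m} {n} m≤n N∣m-n =
  sym (trans (cong (_% N) (sym (ℕₚ.m+[n∸m]≡n m≤n))) (%-remove-+ʳ m N∣n∸m))
  where N∣n∸m : N ∣ n ∸ m
        N∣n∸m = subst (N ∣_) (trans (cong ∣_∣ (ℤₚ.m-n≡m⊖n m n)) (ℤₚ.∣⊖∣-≤ m≤n)) (∣⇒∣ᵤ N∣m-n)

∣ᶻ⇒%≡ : ∀ {N} .{{_ : NonZero N}} m n → + N ∣ᶻ + m - + n → m % N ≡ n % N
∣ᶻ⇒%≡ m n N∣m-n with ℕₚ.≤-total m n
... | inj₁ m≤n = ≤∧∣ᶻ⇒%≡ m≤n N∣m-n
... | inj₂ n≤m = sym (≤∧∣ᶻ⇒%≡ n≤m (∣ᶻ-respʳ (-[m-n]≡n-m (+ m) (+ n)) (ℤ∣.∣m⇒∣-m N∣m-n)))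
  where -[m-n]≡n-m : ∀ m n → - (m - n) ≡ n - m
        -[m-n]≡n-m = solve-∀

%≡⇒∣ᶻ : ∀ {N} .{{_ : NonZero N}} m n → m % N ≡ n % N → + N ∣ᶻ + m - + n
%≡⇒∣ᶻ {N} m n m%N≡n%N = ℤ∣.divides (+ (m / N) - + (n / N)) (begin
  + m - + n
    ≡⟨ cong₂ _-_ (division m) (division n) ⟩
  + (m % N) + + (m / N) *ᶻ + N - (+ (n % N) + + (n / N) *ᶻ + N)
    ≡⟨ cong (λ t → + (m % N) + + (m / N) *ᶻ + N - (+ t + + (n / N) *ᶻ + N)) (sym m%N≡n%N) ⟩
  + (m % N) + + (m / N) *ᶻ + N - (+ (m % N) + + (n / N) *ᶻ + N)
    ≡⟨ [r+q₁N]-[r+q₂N]≡[q₁-q₂]N (+ (m % N)) (+ (m / N)) (+ (n / N)) (+ N) ⟩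
  (+ (m / N) - + (n / N)) *ᶻ + N
    ∎)
  where
  open ≡-Reasoning
  division : ∀ m → + m ≡ + (m % N) + + (m / N) *ᶻ + N
  division m = trans (cong +_ (m≡m%n+[m/n]*n m N)) (cong (_+_ (+ (m % N))) (ℤₚ.pos-* (m / N) N))
  [r+q₁N]-[r+q₂N]≡[q₁-q₂]N : ∀ r q₁ q₂ N → r + q₁ *ᶻ N - (r + q₂ *ᶻ N) ≡ (q₁ - q₂) *ᶻ N
  [r+q₁N]-[r+q₂N]≡[q₁-q₂]N = solve-∀

m%[n*o]≡m%o+m/o%n*o : ∀ m n o .{{_ : NonZero n}} .{{_ : NonZero o}} {{_ : NonZero (n * o)}} →
  m % (n * o) ≡ m % o ℕ.+ m / o % n * o
m%[n*o]≡m%o+m/o%n*o m n o = begin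
  m % (n * o)                                ≡⟨ m≡m%n+[m/n]*n (m % (n * o)) o ⟩
  m % (n * o) % o ℕ.+ m % (n * o) / o * o    ≡⟨ cong₂ (λ s t → s ℕ.+ t * o)
                                                      (m∣n⇒o%n%m≡o%m o (n * o) m (ℕ.n∣m*n n))
                                                      (m%[n*o]/o≡m/o%n m n o) ⟩
  m % o ℕ.+ m / o % n * o                    ∎
  where open ≡-Reasoning

∣ᶻ∧/%≡⇒*-∣ᶻ : ∀ {N M} .{{_ : NonZero N}} .{{_ : NonZero M}} m n →
  + N ∣ᶻ + m - + n → m / N % M ≡ n / N % M → + (M * N) ∣ᶻ + m - + n
∣ᶻ∧/%≡⇒*-∣ᶻ {N} {M} m n N∣m-n m/N≡n/N = %≡⇒∣ᶻ m n (begin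
  m % (M * N)                ≡⟨ m%[n*o]≡m%o+m/o%n*o m M N ⟩
  m % N ℕ.+ m / N % M * N    ≡⟨ cong₂ (λ s t → s ℕ.+ t * N) (∣ᶻ⇒%≡ m n N∣m-n) m/N≡n/N ⟩
  n % N ℕ.+ n / N % M * N    ≡⟨ m%[n*o]≡m%o+m/o%n*o n M N ⟨
  n % (M * N)                ∎)
  where
  open ≡-Reasoning
  instance _ = ℕₚ.m*n≢0 M N

sub-∣⇒≡ : ∀ {N} x y → x < N → y < N → + N ∣ᶻ + x - + y → x ≡ y
sub-∣⇒≡ x y x<N y<N N∣x-y =
  trans (sym (m<n⇒m%n≡m x<N)) (trans (∣ᶻ⇒%≡ x y N∣x-y) (m<n⇒m%n≡m y<N))
  where instance _ = ℕ.>-nonZero (ℕₚ.≤-<-trans z≤n x<N)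

infix 4 _∼[_]_

-- In terms of valuations: x ∣ y and v_p(x) = v_p(y).
record _∼[_]_ (x : ℤ) (p : ℕ) (y : ℤ) : Set where
  constructor multiple
  field
    cofactor   : ℤ
    p∤cofactor : ¬ + p ∣ᶻ cofactor
    equality   : y ≡ x *ᶻ cofactor

∼⇒∣ : ∀ {p} → x ∼[ p ] y → x ∣ᶻ y
∼⇒∣ {x} (multiple u _ refl) = ℤ∣.divides u (ℤₚ.*-comm x u)

∼-respˡ : ∀ {p} → x ≡ x′ → x ∼[ p ] y → x′ ∼[ p ] y
∼-respˡ refl x∼y = x∼y

∼-respʳ : ∀ {p} → y ≡ y′ → x ∼[ p ] y → x ∼[ p ] y′
∼-respʳ refl x∼y = x∼y

module _ {p : ℕ} (p-prime : Prime p) where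

  private
    P = + p
    instance
      p≢0 : NonZero p
      p≢0 = prime⇒nonZero p-prime

  euclidsLemmaᶻ : ∀ a b → P ∣ᶻ a *ᶻ b → P ∣ᶻ a ⊎ P ∣ᶻ b
  euclidsLemmaᶻ a b p∣ab = Sum.map ∣ᵤ⇒∣ ∣ᵤ⇒∣
    (euclidsLemma ∣ a ∣ ∣ b ∣ p-prime (subst (p ∣_) (ℤₚ.abs-* a b) (∣⇒∣ᵤ p∣ab)))

  ∤-* : ¬ P ∣ᶻ a → ¬ P ∣ᶻ b → ¬ P ∣ᶻ a *ᶻ b
  ∤-* p∤a p∤b p∣ab = [ p∤a , p∤b ]′ (euclidsLemmaᶻ _ _ p∣ab)

  ∤1 : ¬ P ∣ᶻ + 1
  ∤1 p∣1 = ℕₚ.<⇒≢ (ℕ.nonTrivial⇒n>1 p {{prime⇒nonTrivial p-prime}}) (sym (∣1⇒≡1 (∣⇒∣ᵤ p∣1)))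

  ∤-^ : ¬ P ∣ᶻ a → ∀ e → ¬ P ∣ᶻ a ^ᶻ e
  ∤-^ p∤a zero    = ∤1
  ∤-^ p∤a (suc e) = ∤-* p∤a (∤-^ p∤a e)

  ∤-resp-≡-mod : P ∣ᶻ a - b → ¬ P ∣ᶻ b → ¬ P ∣ᶻ a
  ∤-resp-≡-mod {a} {b} p∣a-b p∤b p∣a =
    p∤b (∣ᶻ-respʳ (a-[a-b]≡b a b) (ℤ∣.∣m∣n⇒∣m-n p∣a p∣a-b))
    where a-[a-b]≡b : ∀ a b → a - (a - b) ≡ b
          a-[a-b]≡b = solve-∀

  ∼-reflexive : x ≡ y → x ∼[ p ] y
  ∼-reflexive {x} refl = multiple (+ 1) ∤1 (sym (ℤₚ.*-identityʳ x))

  ∼-trans : x ∼[ p ] y → y ∼[ p ] z → x ∼[ p ] z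
  ∼-trans {x} (multiple u p∤u refl) (multiple v p∤v refl) =
    multiple (u *ᶻ v) (∤-* p∤u p∤v) (ℤₚ.*-assoc x u v)

  ∼-* : x ∼[ p ] y → x′ ∼[ p ] y′ → x *ᶻ x′ ∼[ p ] y *ᶻ y′
  ∼-* {x} {x′ = x′} (multiple u p∤u refl) (multiple v p∤v refl) =
    multiple (u *ᶻ v) (∤-* p∤u p∤v) (interchange x u x′ v)
    where interchange : ∀ x u x′ v → x *ᶻ u *ᶻ (x′ *ᶻ v) ≡ x *ᶻ x′ *ᶻ (u *ᶻ v)
          interchange = solve-∀

  ∼-*ˡ : ∀ c → x ∼[ p ] y → c *ᶻ x ∼[ p ] c *ᶻ y
  ∼-*ˡ {x} {y} c = ∼-* {x = c} {y = c} {x′ = x} {y′ = y} (∼-reflexive refl)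

  ∼-of-≡-mod-p² : ¬ P ∣ᶻ v → P *ᶻ P ∣ᶻ w - P *ᶻ v → P ∼[ p ] w
  ∼-of-≡-mod-p² {v} {w} p∤v (ℤ∣.divides k w-pv≡kp²) = multiple (v + k *ᶻ P) p∤u w≡pu
    where
    p∤u : ¬ P ∣ᶻ v + k *ᶻ P
    p∤u = ∤-resp-≡-mod (ℤ∣.divides k ([v+kP]-v≡kP v k P)) p∤v
      where [v+kP]-v≡kP : ∀ v k P → v + k *ᶻ P - v ≡ k *ᶻ P
            [v+kP]-v≡kP = solve-∀
    w≡pu : w ≡ P *ᶻ (v + k *ᶻ P)
    w≡pu = begin
      w                          ≡⟨ w≡w-c+c w (P *ᶻ v) ⟩
      w - P *ᶻ v + P *ᶻ v        ≡⟨ cong (_+ P *ᶻ v) w-pv≡kp² ⟩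
      k *ᶻ (P *ᶻ P) + P *ᶻ v     ≡⟨ kP²+Pv≡P[v+kP] k P v ⟩
      P *ᶻ (v + k *ᶻ P)          ∎
      where
      open ≡-Reasoning
      w≡w-c+c : ∀ w c → w ≡ w - c + c
      w≡w-c+c = solve-∀
      kP²+Pv≡P[v+kP] : ∀ k P v → k *ᶻ (P *ᶻ P) + P *ᶻ v ≡ P *ᶻ (v + k *ᶻ P)
      kP²+Pv≡P[v+kP] = solve-∀

  ∼-pow-∣ : ∀ m → x ∼[ p ] y → P ^ᶻ m ∣ᶻ y → P ^ᶻ m ∣ᶻ x
  ∼-pow-∣ {x} zero    _ _ = ℤ∣.divides x (sym (ℤₚ.*-identityʳ x))
  ∼-pow-∣ {x} (suc m) (multiple u p∤u refl) pᵐ⁺¹∣xu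
    with euclidsLemmaᶻ x u (ℤ∣.∣-trans (ℤ∣.divides (P ^ᶻ m) (ℤₚ.*-comm P _)) pᵐ⁺¹∣xu)
  ... | inj₂ p∣u = ⊥-elim (p∤u p∣u)
  ... | inj₁ (ℤ∣.divides x′ refl) =
    ∣ᶻ-respʳ (ℤₚ.*-comm P x′) (ℤ∣.*-monoʳ-∣ P (∼-pow-∣ m (multiple u p∤u refl) pᵐ∣x′u))
    where
    pᵐ∣x′u : P ^ᶻ m ∣ᶻ x′ *ᶻ u
    pᵐ∣x′u = ℤ∣.*-cancelˡ-∣ P (∣ᶻ-respʳ (x′Pu≡P[x′u] x′ P u) pᵐ⁺¹∣xu)
      where x′Pu≡P[x′u] : ∀ x′ P u → x′ *ᶻ P *ᶻ u ≡ P *ᶻ (x′ *ᶻ u)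
            x′Pu≡P[x′u] = solve-∀

-- Geometric sums

geom : ℕ → ℤ → ℤ → ℤ
geom zero    a b = + 0
geom (suc m) a b = a ^ᶻ m + b *ᶻ geom m a b

pow-sub≡sub*geom : ∀ m a b → a ^ᶻ m - b ^ᶻ m ≡ (a - b) *ᶻ geom m a b
pow-sub≡sub*geom zero    a b = sym (ℤₚ.*-zeroʳ (a - b))
pow-sub≡sub*geom (suc m) a b = begin
  a *ᶻ a ^ᶻ m - b *ᶻ b ^ᶻ m                        ≡⟨ split a b (a ^ᶻ m) (b ^ᶻ m) ⟩
  (a - b) *ᶻ a ^ᶻ m + b *ᶻ (a ^ᶻ m - b ^ᶻ m)       ≡⟨ cong (λ z → (a - b) *ᶻ a ^ᶻ m + b *ᶻ z)
                                                          (pow-sub≡sub*geom m a b) ⟩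
  (a - b) *ᶻ a ^ᶻ m + b *ᶻ ((a - b) *ᶻ geom m a b) ≡⟨ collect a b (a ^ᶻ m) (geom m a b) ⟩
  (a - b) *ᶻ geom (suc m) a b                      ∎
  where
  open ≡-Reasoning
  split : ∀ a b A B → a *ᶻ A - b *ᶻ B ≡ (a - b) *ᶻ A + b *ᶻ (A - B)
  split = solve-∀
  collect : ∀ a b A g → (a - b) *ᶻ A + b *ᶻ ((a - b) *ᶻ g) ≡ (a - b) *ᶻ (A + b *ᶻ g)
  collect = solve-∀

pow≡pow+sub*geom : ∀ m a b → a ^ᶻ m ≡ b ^ᶻ m + (a - b) *ᶻ geom m a b
pow≡pow+sub*geom m a b =
  trans (A≡B+[A-B] (a ^ᶻ m) (b ^ᶻ m)) (cong (_+_ (b ^ᶻ m)) (pow-sub≡sub*geom m a b))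
  where A≡B+[A-B] : ∀ A B → A ≡ B + (A - B)
        A≡B+[A-B] = solve-∀

sub∣pow-sub : ∀ m a b → a - b ∣ᶻ a ^ᶻ m - b ^ᶻ m
sub∣pow-sub m a b =
  ∣ᶻ-respʳ (sym (pow-sub≡sub*geom m a b)) (ℤ∣.∣m⇒∣m*n (geom m a b) ℤ∣.∣-refl)

geom≡-mod-sub : ∀ m a b → a - b ∣ᶻ geom (suc m) a b - + suc m *ᶻ b ^ᶻ m
geom≡-mod-sub zero    a b = ℤ∣.divides (+ 0) (trans (base b) (sym (ℤₚ.*-zeroˡ (a - b))))
  where base : ∀ b → + 1 + b *ᶻ + 0 - + 1 *ᶻ + 1 ≡ + 0
        base = solve-∀
geom≡-mod-sub (suc m) a b =
  ∣ᶻ-respʳ (sym (split (a ^ᶻ suc m) b (b ^ᶻ m) (geom (suc m) a b) (+ suc m)))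
    (ℤ∣.∣m∣n⇒∣m+n (sub∣pow-sub (suc m) a b) (ℤ∣.∣n⇒∣m*n b (geom≡-mod-sub m a b)))
  where split : ∀ A b B g c →
          A + b *ᶻ g - (+ 1 + c) *ᶻ (b *ᶻ B) ≡ (A - b *ᶻ B) + b *ᶻ (g - c *ᶻ B)
        split = solve-∀

geom≡-mod-sub² : ∀ m a b →
  (a - b) *ᶻ (a - b) ∣ᶻ
    geom (2 ℕ.+ m) a b - + (2 ℕ.+ m) *ᶻ b ^ᶻ suc m - + ((2 ℕ.+ m) choose 2) *ᶻ (a - b) *ᶻ b ^ᶻ m
geom≡-mod-sub² zero    a b =
  ℤ∣.divides (+ 0) (trans (base a b) (sym (ℤₚ.*-zeroˡ ((a - b) *ᶻ (a - b)))))
  where base : ∀ a b →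
          a *ᶻ + 1 + b *ᶻ (+ 1 + b *ᶻ + 0) - + 2 *ᶻ (b *ᶻ + 1) - + 1 *ᶻ (a - b) *ᶻ + 1 ≡ + 0
        base = solve-∀
geom≡-mod-sub² (suc m) a b =
  ∣ᶻ-respʳ (sym expansion)
    (ℤ∣.∣m∣n⇒∣m+n (ℤ∣.*-monoʳ-∣ d (geom≡-mod-sub (suc m) a b)) (ℤ∣.∣n⇒∣m*n b (geom≡-mod-sub² m a b)))
  where
  open ≡-Reasoning
  d = a - b
  g = geom (2 ℕ.+ m) a b
  c = + (2 ℕ.+ m)
  t = + ((2 ℕ.+ m) choose 2)
  B = b ^ᶻ m
  regroup : ∀ b d g c t B →
    b *ᶻ (b *ᶻ B) + d *ᶻ g + b *ᶻ g - (+ 1 + c) *ᶻ (b *ᶻ (b *ᶻ B)) - (c + t) *ᶻ d *ᶻ (b *ᶻ B)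
      ≡ d *ᶻ (g - c *ᶻ (b *ᶻ B)) + b *ᶻ (g - c *ᶻ (b *ᶻ B) - t *ᶻ d *ᶻ B)
  regroup = solve-∀
  expansion : geom (3 ℕ.+ m) a b - + (3 ℕ.+ m) *ᶻ b ^ᶻ (2 ℕ.+ m)
                - + ((3 ℕ.+ m) choose 2) *ᶻ d *ᶻ b ^ᶻ suc m
            ≡ d *ᶻ (g - c *ᶻ b ^ᶻ suc m) + b *ᶻ (g - c *ᶻ b ^ᶻ suc m - t *ᶻ d *ᶻ B)
  expansion = begin
    geom (3 ℕ.+ m) a b - + (3 ℕ.+ m) *ᶻ b ^ᶻ (2 ℕ.+ m) - + ((3 ℕ.+ m) choose 2) *ᶻ d *ᶻ b ^ᶻ suc m
      ≡⟨ cong₂ (λ A s → A + b *ᶻ g - + (3 ℕ.+ m) *ᶻ b ^ᶻ (2 ℕ.+ m) - + s *ᶻ d *ᶻ b ^ᶻ suc m)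
               (pow≡pow+sub*geom (2 ℕ.+ m) a b) (choose-2-suc (2 ℕ.+ m)) ⟩
    b ^ᶻ (2 ℕ.+ m) + d *ᶻ g + b *ᶻ g - (+ 1 + c) *ᶻ b ^ᶻ (2 ℕ.+ m) - (c + t) *ᶻ d *ᶻ b ^ᶻ suc m
      ≡⟨ regroup b d g c t B ⟩
    d *ᶻ (g - c *ᶻ b ^ᶻ suc m) + b *ᶻ (g - c *ᶻ b ^ᶻ suc m - t *ᶻ d *ᶻ B)
      ∎

-- Lifting the exponent

-- The last condition removes the term (p choose 2) b^(p-2) (a - b) from geom p a b mod p²:
-- it is automatic for odd p, and for p = 2 it says 4 ∣ a - b.
Liftable : ℕ → ℤ → ℤ → Set
Liftable p a b = + p ∣ᶻ a - b × ¬ (+ p ∣ᶻ b) × + p *ᶻ + p ∣ᶻ + (p choose 2) *ᶻ (a - b)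

module _ {p : ℕ} (p-prime : Prime p) where

  private
    P = + p

  pow-sub-∼ : ∀ {q} → ¬ p ∣ q → P ∣ᶻ a - b → ¬ P ∣ᶻ b → a - b ∼[ p ] a ^ᶻ q - b ^ᶻ q
  pow-sub-∼ {q = zero}          p∤0 _ _ = ⊥-elim (p∤0 (p ∣0))
  pow-sub-∼ {a} {b} {q = suc m} p∤q p∣a-b p∤b =
    multiple (geom (suc m) a b) p∤geom (pow-sub≡sub*geom (suc m) a b)
    where
    p∤geom : ¬ P ∣ᶻ geom (suc m) a b
    p∤geom = ∤-resp-≡-mod p-prime (ℤ∣.∣-trans p∣a-b (geom≡-mod-sub m a b))
               (∤-* p-prime (λ (p∣q : P ∣ᶻ + suc m) → p∤q (∣⇒∣ᵤ p∣q)) (∤-^ p-prime p∤b m))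

  liftable-pow : Liftable p a b → ∀ e → Liftable p (a ^ᶻ e) (b ^ᶻ e)
  liftable-pow {a} {b} (p∣a-b , p∤b , p²∣C[a-b]) e =
    ℤ∣.∣-trans p∣a-b (sub∣pow-sub e a b) ,
    ∤-^ p-prime p∤b e ,
    ℤ∣.∣-trans p²∣C[a-b] (ℤ∣.*-monoʳ-∣ (+ (p choose 2)) (sub∣pow-sub e a b))

liftable-odd : ∀ {p} → Prime p → p ≢ 2 → + p ∣ᶻ a - b → ¬ + p ∣ᶻ b → Liftable p a b
liftable-odd {p = p} p-prime p≢2 p∣a-b p∤b =
  p∣a-b , p∤b , *-pres-∣ᶻ {+ p} {+ (p choose 2)} (∣ᵤ⇒∣ (p∣p-choose-2 p-prime p≢2)) p∣a-b

p∼geom : ∀ {p} → Prime p → Liftable p a b → + p ∼[ p ] geom p a b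
p∼geom {a} {b} {p = suc (suc m)} p-prime (p∣a-b , p∤b , p²∣C[a-b]) =
  ∼-of-≡-mod-p² p-prime (∤-^ p-prime p∤b (suc m))
    (∣ᶻ-respʳ (g-c-t+t≡g-c (geom p a b) (P *ᶻ b ^ᶻ suc m) (+ (p choose 2) *ᶻ (a - b) *ᶻ b ^ᶻ m))
      (ℤ∣.∣m∣n⇒∣m+n (ℤ∣.∣-trans (*-pres-∣ᶻ p∣a-b p∣a-b) (geom≡-mod-sub² m a b))
                    (ℤ∣.∣m⇒∣m*n (b ^ᶻ m) p²∣C[a-b])))
  where
  p = suc (suc m)
  P = + p
  g-c-t+t≡g-c : ∀ g c t → g - c - t + t ≡ g - c
  g-c-t+t≡g-c = solve-∀

pow-sub-∼-prime : ∀ {p} → Prime p → Liftable p a b → + p *ᶻ (a - b) ∼[ p ] a ^ᶻ p - b ^ᶻ p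
pow-sub-∼-prime {a} {b} {p} p-prime lift =
  ∼-respˡ (ℤₚ.*-comm (a - b) (+ p)) (∼-respʳ (sym (pow-sub≡sub*geom p a b))
    (∼-*ˡ p-prime (a - b) (p∼geom p-prime lift)))

pow-sub-∼-prime-power : ∀ {p} → Prime p → Liftable p a b → ∀ k →
  (+ p) ^ᶻ k *ᶻ (a - b) ∼[ p ] a ^ᶻ (p ^ k) - b ^ᶻ (p ^ k)
pow-sub-∼-prime-power {a} {b} p-prime lift zero = ∼-reflexive p-prime (1[a-b]≡a1-b1 a b)
  where 1[a-b]≡a1-b1 : ∀ a b → + 1 *ᶻ (a - b) ≡ a *ᶻ + 1 - b *ᶻ + 1
        1[a-b]≡a1-b1 = solve-∀
pow-sub-∼-prime-power {a} {b} {p} p-prime lift (suc k) =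
  ∼-respˡ (reassociate (+ p) ((+ p) ^ᶻ k) (a - b))
    (∼-respʳ (cong₂ _-_ (ℤₚ.^-*-assoc a p (p ^ k)) (ℤₚ.^-*-assoc b p (p ^ k)))
      (∼-trans p-prime (∼-*ˡ p-prime ((+ p) ^ᶻ k) (pow-sub-∼-prime p-prime lift))
                       (pow-sub-∼-prime-power p-prime (liftable-pow p-prime lift p) k)))
  where reassociate : ∀ P Pᵏ d → Pᵏ *ᶻ (P *ᶻ d) ≡ P *ᶻ Pᵏ *ᶻ d
        reassociate = solve-∀

pow-sub-∼-lte : ∀ {p q} → Prime p → ¬ p ∣ q → Liftable p a b → ∀ k →
  (+ p) ^ᶻ k *ᶻ (a - b) ∼[ p ] a ^ᶻ (q * p ^ k) - b ^ᶻ (q * p ^ k)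
pow-sub-∼-lte {a} {b} {p} {q} p-prime p∤q lift@(p∣a-b , p∤b , _) k =
  ∼-respʳ (cong₂ _-_ (ℤₚ.^-*-assoc a q (p ^ k)) (ℤₚ.^-*-assoc b q (p ^ k)))
    (∼-trans p-prime (∼-*ˡ p-prime ((+ p) ^ᶻ k) (pow-sub-∼ p-prime p∤q p∣a-b p∤b))
                     (pow-sub-∼-prime-power p-prime (liftable-pow p-prime lift q) k))

affine : ℕ → ℕ → ℕ → ℤ
affine p r x = + (p * x ℕ.+ r)

affine≡ : ∀ p r x → affine p r x ≡ + p *ᶻ + x + + r
affine≡ p r x = cong (_+ + r) (ℤₚ.pos-* p x)

affine-sub : ∀ p r x y → affine p r x - affine p r y ≡ + p *ᶻ (+ x - + y)
affine-sub p r x y =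
  trans (cong₂ _-_ (affine≡ p r x) (affine≡ p r y)) ([px+r]-[py+r]≡p[x-y] (+ p) (+ x) (+ y) (+ r))
  where [px+r]-[py+r]≡p[x-y] : ∀ p x y r → p *ᶻ x + r - (p *ᶻ y + r) ≡ p *ᶻ (x - y)
        [px+r]-[py+r]≡p[x-y] = solve-∀

p∣affine-sub : ∀ p r x y → + p ∣ᶻ affine p r x - affine p r y
p∣affine-sub p r x y = ℤ∣.divides (+ x - + y) (trans (affine-sub p r x y) (ℤₚ.*-comm (+ p) _))

p∤affine : ∀ {p r} x → 0 < r → r < p → ¬ + p ∣ᶻ affine p r x
p∤affine {p} {r} x 0<r r<p p∣px+r = ℕₚ.<⇒≱ r<p (∣⇒≤ {{ℕ.>-nonZero 0<r}} (∣⇒∣ᵤ p∣r))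
  where
  p∣r : + p ∣ᶻ + r
  p∣r = ∣ᶻ-respʳ (trans (cong (_- + p *ᶻ + x) (affine≡ p r x)) ([px+r]-px≡r (+ p) (+ x) (+ r)))
          (ℤ∣.∣m∣n⇒∣m-n p∣px+r (ℤ∣.∣m⇒∣m*n (+ x) ℤ∣.∣-refl))
    where [px+r]-px≡r : ∀ p x r → p *ᶻ x + r - p *ᶻ x ≡ r
          [px+r]-px≡r = solve-∀

affine-pow-sub-∼ : ∀ {p q r k} → Prime p → ¬ p ∣ q → 0 < r → r < p → k ≡ 0 ⊎ p ≢ 2 → ∀ x y →
  (+ p) ^ᶻ suc k *ᶻ (+ x - + y) ∼[ p ]
    affine p r x ^ᶻ (q * p ^ k) - affine p r y ^ᶻ (q * p ^ k)
affine-pow-sub-∼ {p} {q} {r} {zero} p-prime p∤q 0<r r<p _ x y =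
  ∼-respˡ (trans (affine-sub p r x y) (pd≡p1d (+ p) (+ x - + y)))
    (∼-respʳ (cong (λ e → affine p r x ^ᶻ e - affine p r y ^ᶻ e) (sym (ℕₚ.*-identityʳ q)))
      (pow-sub-∼ p-prime p∤q (p∣affine-sub p r x y) (p∤affine y 0<r r<p)))
  where pd≡p1d : ∀ p d → p *ᶻ d ≡ p *ᶻ + 1 *ᶻ d
        pd≡p1d = solve-∀
affine-pow-sub-∼ {p} {q} {r} {suc k} p-prime p∤q 0<r r<p (inj₂ p≢2) x y =
  ∼-respˡ (trans (cong ((+ p) ^ᶻ suc k *ᶻ_) (affine-sub p r x y))
                 (reassociate (+ p) ((+ p) ^ᶻ k) (+ x - + y)))
    (pow-sub-∼-lte p-prime p∤q (liftable-odd {a = affine p r x} {b = affine p r y} p-prime p≢2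
                                  (p∣affine-sub p r x y) (p∤affine y 0<r r<p)) (suc k))
  where reassociate : ∀ p pᵏ d → p *ᶻ pᵏ *ᶻ (p *ᶻ d) ≡ p *ᶻ (p *ᶻ pᵏ) *ᶻ d
        reassociate = solve-∀

-- For p = 2, a - b = 2 (x - y) need not be divisible by 4, so the lifting starts from
-- A² - B² = (A - B)(A + B) with A = a^q, B = b^q, both factors even; A + B = a^q - (-b)^q as q is odd.
affine₂-pow-sub-∼ : ∀ {q} → ¬ 2 ∣ q → ∀ k x y →
  (+ 2) ^ᶻ suc (suc k) *ᶻ ((+ x - + y) *ᶻ (+ 1 + + x + + y)) ∼[ 2 ]
    affine 2 1 x ^ᶻ (q * 2 ^ suc k) - affine 2 1 y ^ᶻ (q * 2 ^ suc k)
affine₂-pow-sub-∼ {q} 2∤q k x y =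
  ∼-respˡ (trans (cong ((+ 2) ^ᶻ k *ᶻ_) (cong₂ _*ᶻ_ (affine-sub 2 1 x y) a+b≡2[1+x+y]))
                 (regroup (+ 2) ((+ 2) ^ᶻ k) (+ x - + y) (+ 1 + + x + + y)))
    (∼-respʳ (cong₂ _-_ (^-q*2^[1+k] a′) (^-q*2^[1+k] b′))
      (∼-trans prime[2] (∼-*ˡ prime[2] ((+ 2) ^ᶻ k) [a-b][a+b]∼A²-B²)
                        (pow-sub-∼-prime-power prime[2] lift k)))
  where
  a′ = affine 2 1 x
  b′ = affine 2 1 y
  A = a′ ^ᶻ q
  B = b′ ^ᶻ q
  2∤b : ¬ + 2 ∣ᶻ b′
  2∤b = p∤affine y (s≤s z≤n) (s≤s (s≤s z≤n))
  a+b≡2[1+x+y] : a′ - - b′ ≡ + 2 *ᶻ (+ 1 + + x + + y)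
  a+b≡2[1+x+y] = trans (cong₂ (λ u v → u - - v) (affine≡ 2 1 x) (affine≡ 2 1 y))
                       ([2x+1]+[2y+1]≡2[1+x+y] (+ x) (+ y))
    where [2x+1]+[2y+1]≡2[1+x+y] : ∀ x y → + 2 *ᶻ x + + 1 - - (+ 2 *ᶻ y + + 1) ≡ + 2 *ᶻ (+ 1 + x + y)
          [2x+1]+[2y+1]≡2[1+x+y] = solve-∀
  2∣a+b : + 2 ∣ᶻ a′ - - b′
  2∣a+b = ℤ∣.divides (+ 1 + + x + + y) (trans a+b≡2[1+x+y] (ℤₚ.*-comm (+ 2) (+ 1 + + x + + y)))
  a-b∼A-B : a′ - b′ ∼[ 2 ] A - B
  a-b∼A-B = pow-sub-∼ prime[2] 2∤q (p∣affine-sub 2 1 x y) 2∤b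
  a+b∼A+B : a′ - - b′ ∼[ 2 ] A - - B
  a+b∼A+B = ∼-respʳ (cong (_-_ A) (neg-^-odd 2∤q))
    (pow-sub-∼ prime[2] 2∤q 2∣a+b
               (λ 2∣-b → 2∤b (∣ᶻ-respʳ (ℤₚ.neg-involutive b′) (ℤ∣.∣m⇒∣-m 2∣-b))))
  [a-b][a+b]∼A²-B² : (a′ - b′) *ᶻ (a′ - - b′) ∼[ 2 ] A ^ᶻ 2 - B ^ᶻ 2
  [a-b][a+b]∼A²-B² = ∼-respʳ (difference-of-squares A B) (∼-* prime[2] a-b∼A-B a+b∼A+B)
    where difference-of-squares : ∀ A B → (A - B) *ᶻ (A - - B) ≡ A *ᶻ (A *ᶻ + 1) - B *ᶻ (B *ᶻ + 1)
          difference-of-squares = solve-∀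
  4∣A²-B² : + 2 *ᶻ + 2 ∣ᶻ A ^ᶻ 2 - B ^ᶻ 2
  4∣A²-B² = ℤ∣.∣-trans (*-pres-∣ᶻ (p∣affine-sub 2 1 x y) 2∣a+b) (∼⇒∣ [a-b][a+b]∼A²-B²)
  lift : Liftable 2 (A ^ᶻ 2) (B ^ᶻ 2)
  lift = ℤ∣.∣-trans (ℤ∣.∣m⇒∣m*n {+ 2} {+ 2} (+ 2) ℤ∣.∣-refl) 4∣A²-B² ,
         ∤-^ prime[2] (∤-^ prime[2] 2∤b q) 2 ,
         ∣ᶻ-respʳ (sym (ℤₚ.*-identityˡ _)) 4∣A²-B²
  ^-q*2^[1+k] : ∀ c → ((c ^ᶻ q) ^ᶻ 2) ^ᶻ (2 ^ k) ≡ c ^ᶻ (q * 2 ^ suc k)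
  ^-q*2^[1+k] c = trans (ℤₚ.^-*-assoc (c ^ᶻ q) 2 (2 ^ k)) (ℤₚ.^-*-assoc c q (2 ^ suc k))
  regroup : ∀ t tᵏ d s → tᵏ *ᶻ (t *ᶻ d *ᶻ (t *ᶻ s)) ≡ t *ᶻ (t *ᶻ tᵏ) *ᶻ (d *ᶻ s)
  regroup = solve-∀

2∣[1+n]*n : ∀ n → + 2 ∣ᶻ (+ 1 + + n) *ᶻ + n
2∣[1+n]*n n = ∣ᶻ-respʳ (ℤₚ.pos-* (suc n) n)
  (∣ᵤ⇒∣ (ℕ.divides (suc n choose 2) (trans (sym (double-choose-2 n)) (ℕₚ.*-comm 2 (suc n choose 2)))))

-- x - y and 1 + x + y have opposite parity, and 0 < 1 + x + y < 2^(l+1).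
2ˡ⁺¹∣[x-y][1+x+y]⇒≡ : ∀ {l x y} → x < 2 ^ l → y < 2 ^ l →
  (+ 2) ^ᶻ suc l ∣ᶻ (+ x - + y) *ᶻ (+ 1 + + x + + y) → x ≡ y
2ˡ⁺¹∣[x-y][1+x+y]⇒≡ {l} {x} {y} x<2ˡ y<2ˡ 2ˡ⁺¹∣DS with + 2 ℤ∣.∣? (+ 1 + + x + + y)
... | no 2∤S =
  sub-∣⇒≡ x y x<2ˡ y<2ˡ (∣ᶻ-respˡ (sym (pos-^ 2 l))
    (ℤ∣.∣-trans (ℤ∣.∣n⇒∣m*n {(+ 2) ^ᶻ l} (+ 2) ℤ∣.∣-refl)
                (∼-pow-∣ prime[2] (suc l) (multiple (+ 1 + + x + + y) 2∤S refl) 2ˡ⁺¹∣DS)))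
... | yes 2∣S = ⊥-elim (ℕₚ.<⇒≱ S<2ˡ⁺¹ (∣⇒≤ {suc (x ℕ.+ y)} {2 ^ suc l} 2ˡ⁺¹∣S))
  where
  2∤D : ¬ + 2 ∣ᶻ + x - + y
  2∤D 2∣D = p∤affine x (s≤s z≤n) (s≤s (s≤s z≤n))
    (∣ᶻ-respʳ (sym (trans (affine≡ 2 1 x) (2x+1≡[x-y]+[1+x+y] (+ x) (+ y)))) (ℤ∣.∣m∣n⇒∣m+n 2∣D 2∣S))
    where 2x+1≡[x-y]+[1+x+y] : ∀ x y → + 2 *ᶻ x + + 1 ≡ x - y + (+ 1 + x + y)
          2x+1≡[x-y]+[1+x+y] = solve-∀
  2ˡ⁺¹∣S : 2 ^ suc l ∣ suc (x ℕ.+ y)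
  2ˡ⁺¹∣S = ∣⇒∣ᵤ {+ (2 ^ suc l)} {+ 1 + + x + + y} (∣ᶻ-respˡ (sym (pos-^ 2 (suc l)))
    (∼-pow-∣ prime[2] (suc l) (multiple (+ x - + y) 2∤D (ℤₚ.*-comm (+ x - + y) _)) 2ˡ⁺¹∣DS))
  S<2ˡ⁺¹ : suc (x ℕ.+ y) < 2 ^ suc l
  S<2ˡ⁺¹ = subst (suc (x ℕ.+ y) <_) (cong (2 ^ l ℕ.+_) (sym (ℕₚ.+-identityʳ (2 ^ l))))
             (ℕₚ.+-mono-≤-< x<2ˡ y<2ˡ)

α-odd : ∀ {p k} → k ≡ 0 ⊎ p ≢ 2 → α p k ≡ suc k
α-odd {zero}                   _          = refl
α-odd {suc zero}               _          = refl
α-odd {suc (suc zero)} {zero}  _          = refl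
α-odd {suc (suc zero)} {suc k} (inj₁ ())
α-odd {suc (suc zero)} {suc k} (inj₂ 2≢2) = ⊥-elim (2≢2 refl)
α-odd {suc (suc (suc p))}      _          = refl

module _ {p q r k : ℕ} (p-prime : Prime p) (p∤q : ¬ p ∣ q) (0<r : 0 < r) (r<p : r < p)
         (k≡0⊎p≢2 : k ≡ 0 ⊎ p ≢ 2) where

  private
    instance _ = prime⇒nonZero p-prime
    factorization = affine-pow-sub-∼ p-prime p∤q 0<r r<p k≡0⊎p≢2

  affine-pow-≡-mod-odd : ∀ x y →
    (+ p) ^ᶻ α p k ∣ᶻ affine p r x ^ᶻ (q * p ^ k) - affine p r y ^ᶻ (q * p ^ k)
  affine-pow-≡-mod-odd x y =
    ∣ᶻ-respˡ (cong ((+ p) ^ᶻ_) (sym (α-odd k≡0⊎p≢2)))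
      (ℤ∣.∣-trans (ℤ∣.∣m⇒∣m*n {(+ p) ^ᶻ suc k} (+ x - + y) ℤ∣.∣-refl) (∼⇒∣ (factorization x y)))

  affine-pow-injective-odd : ∀ {l x y} → x < p ^ l → y < p ^ l →
    (+ p) ^ᶻ (α p k ℕ.+ l) ∣ᶻ affine p r x ^ᶻ (q * p ^ k) - affine p r y ^ᶻ (q * p ^ k) → x ≡ y
  affine-pow-injective-odd {l} {x} {y} x<pˡ y<pˡ pᵅ⁺ˡ∣Yx-Yy =
    sub-∣⇒≡ x y x<pˡ y<pˡ (∣ᶻ-respˡ (sym (pos-^ p l))
      (pow-+-cancel-∣ (suc k) l (∼-pow-∣ p-prime (suc k ℕ.+ l) (factorization x y)
        (∣ᶻ-respˡ (cong (λ e → (+ p) ^ᶻ (e ℕ.+ l)) (α-odd k≡0⊎p≢2)) pᵅ⁺ˡ∣Yx-Yy))))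

module _ {q} (2∤q : ¬ 2 ∣ q) (k : ℕ) where

  private
    factorization = affine₂-pow-sub-∼ 2∤q k

  affine-pow-≡-mod-two : ∀ x y →
    (+ 2) ^ᶻ α 2 (suc k) ∣ᶻ affine 2 1 x ^ᶻ (q * 2 ^ suc k) - affine 2 1 y ^ᶻ (q * 2 ^ suc k)
  affine-pow-≡-mod-two x y =
    ℤ∣.∣-trans (∣ᶻ-respˡ (ℤₚ.*-comm ((+ 2) ^ᶻ suc (suc k)) (+ 2))
                  (ℤ∣.*-monoʳ-∣ ((+ 2) ^ᶻ suc (suc k)) 2∣[x-y][1+x+y]))
               (∼⇒∣ (factorization x y))
    where
    2∣[x-y][1+x+y] : + 2 ∣ᶻ (+ x - + y) *ᶻ (+ 1 + + x + + y)
    2∣[x-y][1+x+y] = ∣ᶻ-respʳ ([1+x]x-[1+y]y≡[x-y][1+x+y] (+ x) (+ y))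
                       (ℤ∣.∣m∣n⇒∣m-n (2∣[1+n]*n x) (2∣[1+n]*n y))
      where [1+x]x-[1+y]y≡[x-y][1+x+y] : ∀ x y →
              (+ 1 + x) *ᶻ x - (+ 1 + y) *ᶻ y ≡ (x - y) *ᶻ (+ 1 + x + y)
            [1+x]x-[1+y]y≡[x-y][1+x+y] = solve-∀

  affine-pow-injective-two : ∀ {l x y} → x < 2 ^ l → y < 2 ^ l →
    (+ 2) ^ᶻ (α 2 (suc k) ℕ.+ l) ∣ᶻ affine 2 1 x ^ᶻ (q * 2 ^ suc k) - affine 2 1 y ^ᶻ (q * 2 ^ suc k) →
    x ≡ y
  affine-pow-injective-two {l} {x} {y} x<2ˡ y<2ˡ 2ᵅ⁺ˡ∣Yx-Yy =
    2ˡ⁺¹∣[x-y][1+x+y]⇒≡ {l} x<2ˡ y<2ˡ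
      (pow-+-cancel-∣ {(+ x - + y) *ᶻ (+ 1 + + x + + y)} {p = 2} (suc (suc k)) (suc l)
        (∼-pow-∣ prime[2] (suc (suc k) ℕ.+ suc l) (factorization x y)
          (∣ᶻ-respˡ (cong (λ e → (+ 2) ^ᶻ suc (suc e)) (sym (ℕₚ.+-suc k l))) 2ᵅ⁺ˡ∣Yx-Yy)))

r≡1 : ∀ {r} → 0 < r → r < 2 → r ≡ 1
r≡1 (s≤s z≤n) (s≤s (s≤s z≤n)) = refl

affine-pow-≡-mod : ∀ {p q r} → Prime p → ¬ p ∣ q → 0 < r → r < p → ∀ k x y →
  (+ p) ^ᶻ α p k ∣ᶻ affine p r x ^ᶻ (q * p ^ k) - affine p r y ^ᶻ (q * p ^ k)
affine-pow-≡-mod p-prime p∤q 0<r r<p zero = affine-pow-≡-mod-odd p-prime p∤q 0<r r<p (inj₁ refl)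
affine-pow-≡-mod {p} p-prime p∤q 0<r r<p (suc k) with p ℕ.≟ 2
... | no p≢2 = affine-pow-≡-mod-odd p-prime p∤q 0<r r<p (inj₂ p≢2)
... | yes refl with r≡1 0<r r<p
...   | refl = affine-pow-≡-mod-two p∤q k

affine-pow-injective : ∀ {p q r} → Prime p → ¬ p ∣ q → 0 < r → r < p → ∀ k {l x y} →
  x < p ^ l → y < p ^ l →
  (+ p) ^ᶻ (α p k ℕ.+ l) ∣ᶻ affine p r x ^ᶻ (q * p ^ k) - affine p r y ^ᶻ (q * p ^ k) → x ≡ y
affine-pow-injective p-prime p∤q 0<r r<p zero =
  affine-pow-injective-odd p-prime p∤q 0<r r<p (inj₁ refl)
affine-pow-injective {p} p-prime p∤q 0<r r<p (suc k) with p ℕ.≟ 2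
... | no p≢2 = affine-pow-injective-odd p-prime p∤q 0<r r<p (inj₂ p≢2)
... | yes refl with r≡1 0<r r<p
...   | refl = affine-pow-injective-two p∤q k

injective⇒surjective : ∀ {n} (f : Fin n → Fin n) → Injective _≡_ _≡_ f → Surjective _≡_ _≡_ f
injective⇒surjective {suc m} f f-injective y with Finₚ.any? (λ x → f x Fin.≟ y)
... | yes (x , fx≡y) = x , λ { refl → fx≡y }
... | no ∄x = ⊥-elim (ℕₚ.<-irrefl refl (Finₚ.injective⇒≤ g-injective))
  where
  y≢f : ∀ x → y ≢ f x
  y≢f x y≡fx = ∄x (x , sym y≡fx)
  g : Fin (suc m) → Fin m
  g x = Fin.punchOut (y≢f x)
  g-injective : Injective _≡_ _≡_ g
  g-injective {a} {b} ga≡gb = f-injective (Finₚ.punchOut-injective (y≢f a) (y≢f b) ga≡gb)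

C-injective : ∀ {p q k l r} (p-prime : Prime p) → ¬ p ∣ q → 0 < r → r < p →
  Injective _≡_ _≡_ (C p k (q * p ^ k) l r {{prime⇒nonZero p-prime}})
C-injective {p} {q} {k} {l} {r} p-prime p∤q 0<r r<p {x₁} {x₂} Cx₁≡Cx₂ =
  Finₚ.toℕ-injective (affine-pow-injective p-prime p∤q 0<r r<p k (Finₚ.toℕ<n x₁) (Finₚ.toℕ<n x₂)
    (∣ᶻ-respˡ pˡpᵅ≡pᵅ⁺ˡ (∣ᶻ-respʳ (Y-cast x₁ x₂)
      (∣ᶻ∧/%≡⇒*-∣ᶻ (Y x₁) (Y x₂) pᵅ∣Y-Y (Finₚ.fromℕ<-injective _ _ _ _ Cx₁≡Cx₂)))))
  where
  instance
    _ = prime⇒nonZero p-prime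
    _ = ℕₚ.m^n≢0 p (α p k)
    _ = ℕₚ.m^n≢0 p l
  n = q * p ^ k
  Y : Fin (p ^ l) → ℕ
  Y x = (p * toℕ x ℕ.+ r) ^ n
  Y-cast : ∀ x₁ x₂ → + Y x₁ - + Y x₂ ≡ affine p r (toℕ x₁) ^ᶻ n - affine p r (toℕ x₂) ^ᶻ n
  Y-cast x₁ x₂ = cong₂ _-_ (pos-^ _ n) (pos-^ _ n)
  pᵅ∣Y-Y : + (p ^ α p k) ∣ᶻ + Y x₁ - + Y x₂
  pᵅ∣Y-Y = ∣ᶻ-respˡ (sym (pos-^ p (α p k)))
    (∣ᶻ-respʳ (sym (Y-cast x₁ x₂)) (affine-pow-≡-mod p-prime p∤q 0<r r<p k (toℕ x₁) (toℕ x₂)))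
  pˡpᵅ≡pᵅ⁺ˡ : + (p ^ l * p ^ α p k) ≡ (+ p) ^ᶻ (α p k ℕ.+ l)
  pˡpᵅ≡pᵅ⁺ˡ = trans (cong +_ (trans (ℕₚ.*-comm (p ^ l) _) (sym (ℕₚ.^-distribˡ-+-* p (α p k) l))))
                    (pos-^ p (α p k ℕ.+ l))

theorem1 : (n l p q k : ℕ) → 1 ≤ n → 1 ≤ l → (pp : Prime p) →
           n ≡ q * p ^ k → ¬ (p ∣ q) →
           (r : ℕ) → 0 < r → r < p →
           Bijective _≡_ _≡_ (C p k n l r {{prime⇒nonZero pp}})
theorem1 n l p q k _ _ pp refl p∤q r 0<r r<p =
  injective , injective⇒surjective _ injective
  where injective = C-injective {k = k} {l = l} pp p∤q 0<r r<p
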